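{- Let $e=2$, $q=4$. Fix $\lambda\in\mathbb{F}_q$ with $\operatorname{Tr}_q(\lambda)=1$, let $V=\mathbb{F}_q/\mathbb{F}_2$, $\mathcal T=\{A\in\mathbb{F}_q:\operatorname{Tr}_q(A)=1\}$, $P(A)=A+A^{ -1}+A^{ -2}$, and for $\delta,v\in\mathbb{F}_q$ put $\widehat h_\delta(v)=\sum_{A\in\mathcal T}(-1)^{\operatorname{Tr}_q(\delta P(A))+\operatorname{Tr}_q(vA)}$. For $\delta\in\mathbb{F}_q^*$ define $\widetilde S_\delta$ on $V$ by $\widetilde S_\delta(0+\mathbb{F}_2)=0$ and $\widetilde S_\delta(v+\mathbb{F}_2)=q^{ -1/2}(-1)^{\operatorname{Tr}_q(\lambda v)}\widehat h_{\delta(v^{q/2}+v)^3}(v)$ for $v\notin\mathbb{F}_2$. If $\delta$ is a cube in $\mathbb{F}_q^*$, then $\widetilde S_\delta\equiv0$ on $V$.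
   Context: $\operatorname{Tr}_q$ is the absolute trace from $\mathbb{F}_q$ to $\mathbb{F}_2$. -}

module Defs where

open import Data.Bool using (Bool; true; false; if_then_else_; _xor_)
open import Data.List using (List; []; _∷_; map; filterᵇ; foldr)
open import Data.Rational using (ℚ; 0ℚ; 1ℚ; ½; -_; _+_; _*_)

-- The field F_4 = F_2[ω]/(ω² + ω + 1): elements 0, 1, ω, ω² (written w2).
data F4 : Set where
  f0 f1 fω fω² : F4

infixl 6 _⊕_
infixl 7 _⊗_

_⊕_ : F4 → F4 → F4
f0  ⊕ y   = y
x   ⊕ f0  = x
f1  ⊕ f1  = f0
f1  ⊕ fω  = fω²
f1  ⊕ fω² = fω
fω  ⊕ f1  = fω²
fω  ⊕ fω  = f0
fω  ⊕ fω² = f1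
fω² ⊕ f1  = fω
fω² ⊕ fω  = f1
fω² ⊕ fω² = f0

_⊗_ : F4 → F4 → F4
f0  ⊗ y   = f0
x   ⊗ f0  = f0
f1  ⊗ y   = y
x   ⊗ f1  = x
fω  ⊗ fω  = fω²
fω  ⊗ fω² = f1
fω² ⊗ fω  = f1
fω² ⊗ fω² = fω

-- multiplicative inverse (0⁻¹ := 0 by convention; only used on nonzero A)
inv : F4 → F4
inv f0  = f0
inv f1  = f1
inv fω  = fω²
inv fω² = fω

allF4 : List F4
allF4 = f0 ∷ f1 ∷ fω ∷ fω² ∷ []

-- F_2 = Bool (false = 0, true = 1, addition = xor).
-- Absolute trace Tr_4(x) = x + x², which lies in the prime field F_2 = {f0, f1}.
Tr : F4 → Bool
Tr x with x ⊕ x ⊗ x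
... | f1 = true
... | _  = false   -- only f0 occurs

sgn : Bool → ℚ
sgn false = 1ℚ
sgn true  = - 1ℚ

P : F4 → F4
P A = A ⊕ inv A ⊕ inv A ⊗ inv A

𝒯 : List F4
𝒯 = filterᵇ Tr allF4

sumℚ : List ℚ → ℚ
sumℚ = foldr _+_ 0ℚ

hhat : F4 → F4 → ℚ
hhat δ v = sumℚ (map (λ A → sgn (Tr (δ ⊗ P A) xor Tr (v ⊗ A))) 𝒯)

inF2 : F4 → Bool
inF2 f0 = true
inF2 f1 = true
inF2 _  = false

-- S̃_δ evaluated at the coset v + F_2 through the representative v;
-- q^{-1/2} = 4^{-1/2} = 1/2, and v^{q/2} = v².
Stilde : (λ₀ δ : F4) → F4 → ℚ
Stilde λ₀ δ v =
  if inF2 v then 0ℚ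
  else ½ * (sgn (Tr (λ₀ ⊗ v)) * hhat (δ ⊗ ((v ⊗ v ⊕ v) ⊗ (v ⊗ v ⊕ v) ⊗ (v ⊗ v ⊕ v))) v)

{-# OPTIONS --safe #-}
module Submission where

-- Every element of F₄* is a cube root of unity, so the only cube is δ = 1, and
-- v² + v = 1 for v ∉ F₂; hence S̃_δ(v) is a multiple of ĥ₁(v). On 𝒯 = {ω, ω²}
-- the map P swaps ω and ω², so Tr(P(A)) = 1 throughout, while vA runs over
-- {1, v²}, where the trace takes both values; the two terms of ĥ₁(v) cancel.

open import Defs
open import Data.Bool using (true; false)
open import Data.Empty using (⊥-elim)
open import Data.Product using (∃-syntax; _×_; _,_)
open import Data.Rational using (0ℚ; ½; _*_)
open import Data.Rational.Properties using (*-zeroʳ)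
open import Relation.Binary.PropositionalEquality using (_≡_; _≢_; refl; cong)

cube-of-nonzero : ∀ x → x ≢ f0 → x ⊗ x ⊗ x ≡ f1
cube-of-nonzero f0  x≢0 = ⊥-elim (x≢0 refl)
cube-of-nonzero f1  _   = refl
cube-of-nonzero fω  _   = refl
cube-of-nonzero fω² _   = refl

square+self-outside-F2 : ∀ v → inF2 v ≡ false → v ⊗ v ⊕ v ≡ f1
square+self-outside-F2 fω  _ = refl
square+self-outside-F2 fω² _ = refl

hhat-one-outside-F2 : ∀ v → inF2 v ≡ false → hhat f1 v ≡ 0ℚ
hhat-one-outside-F2 fω  _ = refl
hhat-one-outside-F2 fω² _ = refl

lemma2p8 : (λ₀ : F4) → Tr λ₀ ≡ true →
    (δ : F4) → δ ≢ f0 → (∃[ x ] (x ≢ f0 × δ ≡ x ⊗ x ⊗ x)) →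
    (v : F4) → Stilde λ₀ δ v ≡ 0ℚ
lemma2p8 λ₀ _ δ _ (x , x≢0 , δ≡x³) v with inF2 v in v∉F2
... | true  = refl
... | false
  rewrite square+self-outside-F2 v v∉F2
        | δ≡x³
        | cube-of-nonzero x x≢0
        | hhat-one-outside-F2 v v∉F2
  = cong (½ *_) (*-zeroʳ (sgn (Tr (λ₀ ⊗ v))))
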